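{- For each of the following sets $H$ of graphs, there exists a finite simple graph $G$ that contains no member of $H$ as an induced subgraph and whose chromatic symmetric function $X_G$ is not $e$-positive: $H=\{\text{claw},\text{diamond}\}$, $H=\{\text{claw},K_4\}$, $H=\{\text{claw},4K_1\}$, $H=\{\text{claw},C_4\}$, $H=\{\text{claw},2K_2\}$, $H=\{\text{claw},\text{co-claw}\}$.
   Context: For a finite simple graph $G$ with vertex set $\{v_1,\dots,v_N\}$, the chromatic symmetric function is $X_G=\sum_{\kappa} x_{\kappa(v_1)}\cdots x_{\kappa(v_N)}$, summed over all proper colorings $\kappa:V\to\mathbb{Z}^+$ (adjacent vertices receive different colors). A symmetric function is $e$-positive if it is a nonnegative linear combination of elementary symmetric functions $e_\lambda=e_{\lambda_1}\cdots e_{\lambda_\ell}$, where $e_i=\sum_{j_1<\dots<j_i}x_{j_1}\cdots x_{j_i}$. Four-vertex graphs: claw $=K_{1,3}$; diamond $=K_4$ minus one edge; $K_4$ the complete graph; $4K_1$ four isolated vertices; $C_4$ the 4-cycle; $2K_2$ two disjoint edges; co-claw $=$ a triangle plus an isolated vertex. -}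

module Defs where

open import Data.Nat using (ℕ; zero; suc; _+_; _∸_; _≤ᵇ_; _≡ᵇ_)
open import Data.Bool using (Bool; true; false; _∧_; _∨_; not; if_then_else_)
open import Data.Fin using (Fin; zero; suc)
import Data.Fin as Fin
open import Data.List using (List; []; _∷_; map; concatMap; foldr; allFin)
open import Data.Bool.ListAction using (all)
open import Data.Nat.ListAction using (sum)
open import Data.List.Relation.Unary.All using (All)
open import Data.Product using (Σ; _×_; _,_; proj₁; proj₂)
open import Data.Integer using (+_)
open import Data.Rational using (ℚ; _/_; 0ℚ; _≤_)
import Data.Rational as ℚ
open import Relation.Binary.PropositionalEquality using (_≡_; refl)
open import Relation.Nullary using (¬_; ⌊_⌋)
open import Function.Definitions using (Injective)

record Graph (N : ℕ) : Set where
  field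
    adj    : Fin N → Fin N → Bool
    sym    : ∀ i j → adj i j ≡ adj j i
    irrefl : ∀ i → adj i i ≡ false
open Graph public

Induced : ∀ {M N} → Graph M → Graph N → Set
Induced {M} {N} H G =
  Σ (Fin M → Fin N) λ f →
    Injective _≡_ _≡_ f × (∀ i j → adj G (f i) (f j) ≡ adj H i j)

-- The four-vertex graphs, given by the six bits for the pairs
-- 01, 02, 03, 12, 13, 23.

adj4 : Bool → Bool → Bool → Bool → Bool → Bool → Fin 4 → Fin 4 → Bool
adj4 a b c d e f zero zero = false
adj4 a b c d e f zero (suc zero) = a
adj4 a b c d e f zero (suc (suc zero)) = b
adj4 a b c d e f zero (suc (suc (suc zero))) = c
adj4 a b c d e f (suc zero) zero = a
adj4 a b c d e f (suc zero) (suc zero) = false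
adj4 a b c d e f (suc zero) (suc (suc zero)) = d
adj4 a b c d e f (suc zero) (suc (suc (suc zero))) = e
adj4 a b c d e f (suc (suc zero)) zero = b
adj4 a b c d e f (suc (suc zero)) (suc zero) = d
adj4 a b c d e f (suc (suc zero)) (suc (suc zero)) = false
adj4 a b c d e f (suc (suc zero)) (suc (suc (suc zero))) = f
adj4 a b c d e f (suc (suc (suc zero))) zero = c
adj4 a b c d e f (suc (suc (suc zero))) (suc zero) = e
adj4 a b c d e f (suc (suc (suc zero))) (suc (suc zero)) = f
adj4 a b c d e f (suc (suc (suc zero))) (suc (suc (suc zero))) = false

adj4-sym : ∀ a b c d e f i j → adj4 a b c d e f i j ≡ adj4 a b c d e f j i
adj4-sym a b c d e f zero zero = refl
adj4-sym a b c d e f zero (suc zero) = refl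
adj4-sym a b c d e f zero (suc (suc zero)) = refl
adj4-sym a b c d e f zero (suc (suc (suc zero))) = refl
adj4-sym a b c d e f (suc zero) zero = refl
adj4-sym a b c d e f (suc zero) (suc zero) = refl
adj4-sym a b c d e f (suc zero) (suc (suc zero)) = refl
adj4-sym a b c d e f (suc zero) (suc (suc (suc zero))) = refl
adj4-sym a b c d e f (suc (suc zero)) zero = refl
adj4-sym a b c d e f (suc (suc zero)) (suc zero) = refl
adj4-sym a b c d e f (suc (suc zero)) (suc (suc zero)) = refl
adj4-sym a b c d e f (suc (suc zero)) (suc (suc (suc zero))) = refl
adj4-sym a b c d e f (suc (suc (suc zero))) zero = refl
adj4-sym a b c d e f (suc (suc (suc zero))) (suc zero) = refl
adj4-sym a b c d e f (suc (suc (suc zero))) (suc (suc zero)) = refl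
adj4-sym a b c d e f (suc (suc (suc zero))) (suc (suc (suc zero))) = refl

adj4-irr : ∀ a b c d e f i → adj4 a b c d e f i i ≡ false
adj4-irr a b c d e f zero = refl
adj4-irr a b c d e f (suc zero) = refl
adj4-irr a b c d e f (suc (suc zero)) = refl
adj4-irr a b c d e f (suc (suc (suc zero))) = refl

graph4 : Bool → Bool → Bool → Bool → Bool → Bool → Graph 4
graph4 a b c d e f = record
  { adj = adj4 a b c d e f ; sym = adj4-sym a b c d e f ; irrefl = adj4-irr a b c d e f }

--                    01    02    03    12    13    23
claw    = graph4 true  true  true  false false false
diamond = graph4 true  true  true  true  true  false
K4      = graph4 true  true  true  true  true  true
4K1     = graph4 false false false false false false
C4      = graph4 true  false true  true  false true
2K2     = graph4 true  false false false false true
co-claw = graph4 true  true  false true  false false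

count : ∀ {A : Set} → (A → Bool) → List A → ℕ
count p xs = sum (map (λ x → if p x then 1 else 0) xs)

extend : ∀ {N n} → Fin n → (Fin N → Fin n) → Fin (suc N) → Fin n
extend c f zero = c
extend c f (suc i) = f i

allFuns : ∀ N n → List (Fin N → Fin n)
allFuns zero n = (λ ()) ∷ []
allFuns (suc N) n = concatMap (λ f → map (λ c → extend c f) (allFin n)) (allFuns N n)

allSubsets : ∀ n → List (Fin n → Bool)
allSubsets zero = (λ ()) ∷ []
allSubsets (suc n) = concatMap (λ S → (λ { zero → true  ; (suc i) → S i })
                                    ∷ (λ { zero → false ; (suc i) → S i }) ∷ [])
                               (allSubsets n)

-- Monomial coefficients of X_G restricted to n variables x_0,…,x_{n-1}.
-- An exponent vector is α : Fin n → ℕ (the monomial ∏ x_i^{α i}).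

proper : ∀ {N n} → Graph N → (Fin N → Fin n) → Bool
proper {N} G κ = all (λ u → all (λ v → not (adj G u v ∧ ⌊ κ u Fin.≟ κ v ⌋)) (allFin N)) (allFin N)

hasExponent : ∀ {N n} → (Fin N → Fin n) → (Fin n → ℕ) → Bool
hasExponent {N} {n} κ α =
  all (λ i → count (λ v → ⌊ κ v Fin.≟ i ⌋) (allFin N) ≡ᵇ α i) (allFin n)

-- coefficient of x^α in X_G(x_0,…,x_{n-1},0,0,…)
chromCoeff : ∀ {N} → Graph N → (n : ℕ) → (Fin n → ℕ) → ℕ
chromCoeff {N} G n α = count (λ κ → proper G κ ∧ hasExponent κ α) (allFuns N n)

-- Monomial coefficients of e_λ = e_{λ_1}⋯e_{λ_ℓ} in n variables.
-- e_k = Σ_{|S| = k} ∏_{j∈S} x_j, so the coefficient of x^α in e_k · e_μ is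
-- Σ_{S ⊆ [n], |S| = k, S ≤ α} [coefficient of x^{α - S} in e_μ].
eCoeff : (n : ℕ) → List ℕ → (Fin n → ℕ) → ℕ
eCoeff n [] α = if all (λ i → α i ≡ᵇ 0) (allFin n) then 1 else 0
eCoeff n (k ∷ μ) α =
  sum (map (λ S → if (count S (allFin n) ≡ᵇ k)
                        ∧ all (λ i → if S i then 1 ≤ᵇ α i else true) (allFin n)
                  then eCoeff n μ (λ i → if S i then α i ∸ 1 else α i)
                  else 0)
           (allSubsets n))

toℚ : ℕ → ℚ
toℚ m = + m / 1

-- e-positivity: X_G = Σ c_λ e_λ with all c_λ ≥ 0 (rational), where
-- equality of symmetric functions is equality of every monomial
-- coefficient in every finite number n of variables.

IsEPositive : ∀ {N} → Graph N → Set
IsEPositive G =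
  Σ (List (ℚ × List ℕ)) λ L →
    All (λ p → 0ℚ ≤ proj₁ p) L ×
    (∀ (n : ℕ) (α : Fin n → ℕ) →
       toℚ (chromCoeff G n α)
         ≡ foldr (λ p acc → proj₁ p ℚ.* toℚ (eCoeff n (proj₂ p) α) ℚ.+ acc) 0ℚ L)

NonEPositiveFree : Graph 4 → Graph 4 → Set
NonEPositiveFree H₁ H₂ =
  Σ ℕ λ N → Σ (Graph N) λ G →
    ¬ Induced H₁ G × ¬ Induced H₂ G × ¬ IsEPositive G

-- The net (a triangle 0,1,2 with pendant vertices 3,4,5 attached to 0,1,2)
-- witnesses all six pairs: it is claw-free, avoids the second graph of each
-- pair, and X_net is not e-positive.
--
-- Freeness is a Boolean test over all maps Fin 4 → Fin 6 ('allFuns'), sound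
-- for 'Induced' because every map agrees pointwise with an enumerated one.
--
-- Non-e-positivity uses a separating linear functional: 'e₃₃-coefficient'
-- reads off the coefficient of e₍₃,₃₎ from seven degree-6 monomial
-- coefficients in three variables.  It is nonnegative on every e_μ but equals
-- -6 on X_net, and by linearity it is nonnegative on every nonnegative
-- combination of e_μ's.  Nonnegativity on all index lists μ reduces to the 24
-- compositions of 6 into parts 1, 2, 3 (checked by evaluation) through three
-- general facts about e_μ in n variables: e₀ = 1, e_k = 0 for k > n, and
-- homogeneity.
module Submission where

open import Defs hiding (sym)
open import Data.Nat using (ℕ; zero; suc; _+_; _∸_; _≤_; _<_; _≤ᵇ_; _≡ᵇ_; s≤s; z≤n)
import Data.Nat as ℕ
open import Data.Nat.Properties
  using (+-identityʳ; +-comm; ≡ᵇ⇒≡; ≤-reflexive; ≤-trans; n≤1+n; <-irrefl; ≰⇒>; +-commutativeSemigroup)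
open import Algebra.Properties.CommutativeSemigroup +-commutativeSemigroup using (interchange)
open import Data.Bool using (Bool; true; false; _∧_; _∨_; not; if_then_else_; T)
open import Data.Bool.Properties using (∨-comm)
import Data.Bool as Bool
open import Data.Fin using (Fin; zero; suc)
import Data.Fin as Fin
open import Data.List using (List; []; _∷_; map; foldr; allFin; tabulate; length; _++_; concatMap)
open import Data.List.Properties using (map-cong; map-tabulate; length-tabulate; map-++)
open import Data.List.Membership.Propositional using (_∈_)
open import Data.List.Membership.Propositional.Properties using (∈-allFin; ∈-map⁺; ∈-++⁺ˡ; ∈-++⁺ʳ)
open import Data.List.Relation.Unary.All as All using (All; []; _∷_; all?)
open import Data.List.Relation.Unary.All.Properties using (¬All⇒Any¬)
open import Data.List.Relation.Unary.Any as Any using (Any; here; there)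
open import Data.List.Relation.Unary.Any.Properties using (map⁺; concatMap⁺; tabulate⁺)
open import Data.Bool.ListAction using (all)
open import Data.Nat.ListAction using (sum)
open import Data.Nat.ListAction.Properties using (sum-++)
open import Data.Product using (_×_; _,_; proj₁; proj₂)
open import Data.Empty using (⊥; ⊥-elim)
open import Data.Unit using (tt)
open import Data.Rational using (ℚ; 0ℚ)
import Data.Rational as ℚ
import Data.Rational.Properties as ℚP
open import Data.Rational.Solver using (module +-*-Solver)
open import Function using (_∘_)
open import Function.Definitions using (Injective)
open import Relation.Binary.PropositionalEquality
open import Relation.Nullary using (¬_; yes; no; ⌊_⌋)
open import Relation.Nullary.Decidable using (from-yes)

∧-true : ∀ {a b} → a ∧ b ≡ true → a ≡ true × b ≡ true
∧-true {true} {true} _ = refl , refl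

≡ᵇ-true : ∀ {m n} → (m ≡ᵇ n) ≡ true → m ≡ n
≡ᵇ-true {m} {n} e = ≡ᵇ⇒≡ m n (subst T (sym e) tt)

if-zero : ∀ b {x : ℕ} → (b ≡ true → x ≡ 0) → (if b then x else 0) ≡ 0
if-zero true  x≡0 = x≡0 refl
if-zero false _   = refl

all-intro : ∀ {A : Set} {p : A → Bool} xs → (∀ x → p x ≡ true) → all p xs ≡ true
all-intro []       _ = refl
all-intro (x ∷ xs) h rewrite h x = all-intro xs h

all-cong : ∀ {A : Set} {p q : A → Bool} xs → (∀ x → p x ≡ q x) → all p xs ≡ all q xs
all-cong xs p≗q = cong (foldr _∧_ true) (map-cong p≗q xs)

all-Any-false : ∀ {A : Set} {p : A → Bool} {xs} → all p xs ≡ true → Any (λ x → p x ≡ false) xs → ⊥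
all-Any-false {p = p} {x ∷ _} all≡true (here px≡false) with p x
all-Any-false all≡true (here ()) | true
all-Any-false {p = p} {x ∷ _} all≡true (there rest) with p x
... | true = all-Any-false all≡true rest

sum-zero : ∀ {A : Set} {f : A → ℕ} xs → (∀ x → f x ≡ 0) → sum (map f xs) ≡ 0
sum-zero []       _ = refl
sum-zero (x ∷ xs) h rewrite h x = sum-zero xs h

sum-map-concatMap : ∀ {A B : Set} (g : B → ℕ) (h : A → List B) xs →
  sum (map g (concatMap h xs)) ≡ sum (map (λ x → sum (map g (h x))) xs)
sum-map-concatMap g h []       = refl
sum-map-concatMap g h (x ∷ xs) = begin
  sum (map g (h x ++ concatMap h xs))           ≡⟨ cong sum (map-++ g (h x) _) ⟩
  sum (map g (h x) ++ map g (concatMap h xs))   ≡⟨ sum-++ (map g (h x)) _ ⟩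
  sum (map g (h x)) + sum (map g (concatMap h xs)) ≡⟨ cong (sum (map g (h x)) +_) (sum-map-concatMap g h xs) ⟩
  sum (map g (h x)) + sum (map (λ y → sum (map g (h y))) xs) ∎
  where open ≡-Reasoning

count-≤-length : ∀ {A : Set} (S : A → Bool) xs → count S xs ≤ length xs
count-≤-length S [] = z≤n
count-≤-length S (x ∷ xs) with S x
... | true  = s≤s (count-≤-length S xs)
... | false = ≤-trans (count-≤-length S xs) (n≤1+n _)

count-zero-false : ∀ {A : Set} (S : A → Bool) {xs x} → count S xs ≡ 0 → x ∈ xs → S x ≡ false
count-zero-false S {y ∷ ys} c (here refl) with S y
... | false = refl
count-zero-false S {y ∷ ys} c (there x∈) with S y
... | false = count-zero-false S c x∈

count-tabulate-suc : ∀ {n} (S : Fin (suc n) → Bool) → count S (tabulate Fin.suc) ≡ count (S ∘ suc) (allFin n)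
count-tabulate-suc {n} S =
  cong sum (trans (map-tabulate Fin.suc indicator) (sym (map-tabulate (λ i → i) (indicator ∘ Fin.suc))))
  where
  indicator : Fin (suc n) → ℕ
  indicator i = if S i then 1 else 0

degOn : ∀ {n} → List (Fin n) → (Fin n → ℕ) → ℕ
degOn xs α = sum (map α xs)

deg : ∀ {n} → (Fin n → ℕ) → ℕ
deg {n} α = degOn (allFin n) α

fitsAt : ∀ {n} → (Fin n → ℕ) → (Fin n → Bool) → Fin n → Bool
fitsAt α S i = if S i then 1 ≤ᵇ α i else true

remove : ∀ {n} → (Fin n → ℕ) → (Fin n → Bool) → Fin n → ℕ
remove α S i = if S i then α i ∸ 1 else α i

degOn-remove : ∀ {n} (α : Fin n → ℕ) S xs → all (fitsAt α S) xs ≡ true →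
  degOn xs (remove α S) + count S xs ≡ degOn xs α
degOn-remove α S [] _ = refl
degOn-remove α S (x ∷ xs) fits with ∧-true {fitsAt α S x} fits
... | fx , rest = begin
  (remove α S x + degOn xs (remove α S)) + ((if S x then 1 else 0) + count S xs)
    ≡⟨ interchange (remove α S x) _ _ _ ⟩
  (remove α S x + (if S x then 1 else 0)) + (degOn xs (remove α S) + count S xs)
    ≡⟨ cong₂ _+_ (pointwise (S x) (α x) fx) (degOn-remove α S xs rest) ⟩
  α x + degOn xs α ∎
  where
  open ≡-Reasoning
  pointwise : ∀ b a → (if b then 1 ≤ᵇ a else true) ≡ true →
    (if b then a ∸ 1 else a) + (if b then 1 else 0) ≡ a
  pointwise true  (suc a) _ = +-comm a 1
  pointwise false a       _ = +-identityʳ a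

degOn-zero : ∀ {n} (α : Fin n → ℕ) xs → all (λ i → α i ≡ᵇ 0) xs ≡ true → degOn xs α ≡ 0
degOn-zero α [] _ = refl
degOn-zero α (x ∷ xs) e with ∧-true {α x ≡ᵇ 0} e
... | x0 , rest = cong₂ _+_ (≡ᵇ-true x0) (degOn-zero α xs rest)

count-zero-fits : ∀ {n} (α : Fin n → ℕ) S xs → count S xs ≡ 0 → all (fitsAt α S) xs ≡ true
count-zero-fits α S [] _ = refl
count-zero-fits α S (x ∷ xs) c with S x
... | false = count-zero-fits α S xs c

-- Exactly one subset of Fin n is empty.  Each S ⊆ Fin n gives two subsets of
-- Fin (suc n): with 0 (never empty) and without 0 (empty iff S is).
unique-empty-subset : ∀ n (c : ℕ) →
  sum (map (λ S → if count S (allFin n) ≡ᵇ 0 then c else 0) (allSubsets n)) ≡ c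
unique-empty-subset zero    c = +-identityʳ c
unique-empty-subset (suc n) c =
  split _ (λ S → trans (+-identityʳ _) (cong isEmpty (count-tabulate-suc {n} _)))
  where
  isEmpty : ℕ → ℕ
  isEmpty m = if m ≡ᵇ 0 then c else 0
  split : ∀ (h : (Fin n → Bool) → List (Fin (suc n) → Bool)) →
    (∀ S → sum (map (λ T → isEmpty (count T (allFin (suc n)))) (h S)) ≡ isEmpty (count S (allFin n))) →
    sum (map (λ T → isEmpty (count T (allFin (suc n)))) (concatMap h (allSubsets n))) ≡ c
  split h pointwise = begin
    sum (map (λ T → isEmpty (count T (allFin (suc n)))) (concatMap h (allSubsets n)))
      ≡⟨ sum-map-concatMap _ h (allSubsets n) ⟩
    sum (map (λ S → sum (map (λ T → isEmpty (count T (allFin (suc n)))) (h S))) (allSubsets n))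
      ≡⟨ cong sum (map-cong pointwise (allSubsets n)) ⟩
    sum (map (λ S → isEmpty (count S (allFin n))) (allSubsets n))
      ≡⟨ unique-empty-subset n c ⟩
    c ∎
    where open ≡-Reasoning

eTerm : ∀ n k μ (α : Fin n → ℕ) → (Fin n → Bool) → ℕ
eTerm n k μ α S =
  if (count S (allFin n) ≡ᵇ k) ∧ all (fitsAt α S) (allFin n) then eCoeff n μ (remove α S) else 0

eCoeff-cong : ∀ {n} μ {α β : Fin n → ℕ} → (∀ i → α i ≡ β i) → eCoeff n μ α ≡ eCoeff n μ β
eCoeff-cong {n} [] α≗β =
  cong (λ b → if b then 1 else 0) (all-cong (allFin n) (λ i → cong (_≡ᵇ 0) (α≗β i)))
eCoeff-cong {n} (k ∷ μ) {α} {β} α≗β = cong sum (map-cong term (allSubsets n))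
  where
  term : ∀ S → eTerm n k μ α S ≡ eTerm n k μ β S
  term S = cong₂ (λ b x → if (count S (allFin n) ≡ᵇ k) ∧ b then x else 0)
    (all-cong (allFin n) (λ i → cong (λ a → if S i then 1 ≤ᵇ a else true) (α≗β i)))
    (eCoeff-cong μ (λ i → cong (λ a → if S i then a ∸ 1 else a) (α≗β i)))

eCoeff-tail-cong : ∀ {n} k {μ ν} → (∀ β → eCoeff n μ β ≡ eCoeff n ν β) →
  ∀ α → eCoeff n (k ∷ μ) α ≡ eCoeff n (k ∷ ν) α
eCoeff-tail-cong {n} k {μ} {ν} μ≗ν α = cong sum (map-cong term (allSubsets n))
  where
  term : ∀ S → eTerm n k μ α S ≡ eTerm n k ν α S
  term S = cong (λ x → if (count S (allFin n) ≡ᵇ k) ∧ all (fitsAt α S) (allFin n) then x else 0)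
                (μ≗ν (remove α S))

eCoeff-homogeneous : ∀ {n} μ (α : Fin n → ℕ) → deg α ≢ sum μ → eCoeff n μ α ≡ 0
eCoeff-homogeneous {n} [] α deg≢0 = if-zero _ (λ e → ⊥-elim (deg≢0 (degOn-zero α (allFin n) e)))
eCoeff-homogeneous {n} (k ∷ μ) α deg≢ = sum-zero (allSubsets n) (λ S → if-zero _ (vanish S ∘ ∧-true))
  where
  vanish : ∀ S → (count S (allFin n) ≡ᵇ k) ≡ true × all (fitsAt α S) (allFin n) ≡ true →
    eCoeff n μ (remove α S) ≡ 0
  vanish S (sizeₖ , fits) = eCoeff-homogeneous μ (remove α S) λ degμ → deg≢ (begin
    deg α                                  ≡⟨ degOn-remove α S (allFin n) fits ⟨
    deg (remove α S) + count S (allFin n)  ≡⟨ cong₂ _+_ degμ (≡ᵇ-true sizeₖ) ⟩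
    sum μ + k                              ≡⟨ +-comm (sum μ) k ⟩
    k + sum μ                              ∎)
    where open ≡-Reasoning

eCoeff-large-part : ∀ {n} μ → Any (n <_) μ → ∀ α → eCoeff n μ α ≡ 0
eCoeff-large-part {n} (k ∷ μ) (here n<k) α =
  sum-zero (allSubsets n) (λ S → if-zero _ (λ e → ⊥-elim (too-large S (≡ᵇ-true (proj₁ (∧-true e))))))
  where
  too-large : ∀ S → count S (allFin n) ≢ k
  too-large S refl = <-irrefl refl (≤-trans n<k
    (≤-trans (count-≤-length S (allFin n)) (≤-reflexive (length-tabulate (λ i → i)))))
eCoeff-large-part {n} (k ∷ μ) (there large) α =
  sum-zero (allSubsets n) (λ S → if-zero _ (λ _ → eCoeff-large-part μ large _))

-- e₀ = 1: only the empty subset contributes to e₀ · e_μ.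
eCoeff-zero-part : ∀ {n} μ α → eCoeff n (0 ∷ μ) α ≡ eCoeff n μ α
eCoeff-zero-part {n} μ α =
  trans (cong sum (map-cong only-empty (allSubsets n))) (unique-empty-subset n (eCoeff n μ α))
  where
  only-empty : ∀ S →
    (if (count S (allFin n) ≡ᵇ 0) ∧ all (fitsAt α S) (allFin n) then eCoeff n μ (remove α S) else 0)
      ≡ (if count S (allFin n) ≡ᵇ 0 then eCoeff n μ α else 0)
  only-empty S with count S (allFin n) ≡ᵇ 0 in empty
  ... | false = refl
  ... | true rewrite count-zero-fits α S (allFin n) (≡ᵇ-true empty) =
    eCoeff-cong μ (λ i → cong (λ b → if b then α i ∸ 1 else α i)
                             (count-zero-false S (≡ᵇ-true empty) (∈-allFin i)))

dropZeros : List ℕ → List ℕ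
dropZeros []          = []
dropZeros (zero ∷ μ)  = dropZeros μ
dropZeros (suc k ∷ μ) = suc k ∷ dropZeros μ

dropZeros-positive : ∀ μ → All (0 <_) (dropZeros μ)
dropZeros-positive []          = []
dropZeros-positive (zero ∷ μ)  = dropZeros-positive μ
dropZeros-positive (suc k ∷ μ) = s≤s z≤n ∷ dropZeros-positive μ

eCoeff-dropZeros : ∀ {n} μ α → eCoeff n μ α ≡ eCoeff n (dropZeros μ) α
eCoeff-dropZeros []          α = refl
eCoeff-dropZeros (zero ∷ μ)  α = trans (eCoeff-zero-part μ α) (eCoeff-dropZeros μ α)
eCoeff-dropZeros (suc k ∷ μ) α = eCoeff-tail-cong (suc k) {μ} {dropZeros μ} (eCoeff-dropZeros μ) α

Functional : ℕ → Set
Functional n = List (ℚ × (Fin n → ℕ))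

⟦_⟧ : ∀ {n} → Functional n → ((Fin n → ℕ) → ℚ) → ℚ
⟦ ws ⟧ h = foldr (λ p acc → proj₁ p ℚ.* h (proj₂ p) ℚ.+ acc) 0ℚ ws

⟦⟧-cong : ∀ {n} (ws : Functional n) {h h′ : (Fin n → ℕ) → ℚ} →
  All (λ p → h (proj₂ p) ≡ h′ (proj₂ p)) ws → ⟦ ws ⟧ h ≡ ⟦ ws ⟧ h′
⟦⟧-cong []             []       = refl
⟦⟧-cong ((w , α) ∷ ws) (e ∷ es) = cong₂ (λ a b → w ℚ.* a ℚ.+ b) e (⟦⟧-cong ws es)

⟦⟧-vanishing : ∀ {n} (ws : Functional n) {h : (Fin n → ℕ) → ℕ} →
  All (λ p → h (proj₂ p) ≡ 0) ws → ⟦ ws ⟧ (toℚ ∘ h) ≡ 0ℚ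
⟦⟧-vanishing []             []       = refl
⟦⟧-vanishing ((w , α) ∷ ws) {h} (z ∷ zs) = begin
  w ℚ.* toℚ (h α) ℚ.+ ⟦ ws ⟧ (toℚ ∘ h)  ≡⟨ cong₂ (λ a b → w ℚ.* toℚ a ℚ.+ b) z (⟦⟧-vanishing ws zs) ⟩
  w ℚ.* 0ℚ ℚ.+ 0ℚ                     ≡⟨ ℚP.+-identityʳ _ ⟩
  w ℚ.* 0ℚ                             ≡⟨ ℚP.*-zeroʳ w ⟩
  0ℚ                                   ∎
  where open ≡-Reasoning

⟦⟧-linear : ∀ {n} (ws : Functional n) q (a b : (Fin n → ℕ) → ℚ) →
  ⟦ ws ⟧ (λ α → q ℚ.* a α ℚ.+ b α) ≡ q ℚ.* ⟦ ws ⟧ a ℚ.+ ⟦ ws ⟧ b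
⟦⟧-linear []             q a b = solve 1 (λ q → con 0ℚ := q :* con 0ℚ :+ con 0ℚ) refl q
  where open +-*-Solver using (solve; _:=_; _:*_; _:+_; con)
⟦⟧-linear ((w , α) ∷ ws) q a b =
  trans (cong (w ℚ.* (q ℚ.* a α ℚ.+ b α) ℚ.+_) (⟦⟧-linear ws q a b))
        (solve 6 (λ w q x A y B → w :* (q :* x :+ y) :+ (q :* A :+ B) := q :* (w :* x :+ A) :+ (w :* y :+ B))
               refl w q (a α) (⟦ ws ⟧ a) (b α) (⟦ ws ⟧ b))
  where open +-*-Solver using (solve; _:=_; _:*_; _:+_; con)

eExpansion : ∀ n → List (ℚ × List ℕ) → (Fin n → ℕ) → ℚ
eExpansion n L α = foldr (λ p acc → proj₁ p ℚ.* toℚ (eCoeff n (proj₂ p) α) ℚ.+ acc) 0ℚ L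

⟦⟧-expansion-nonneg : ∀ {n} (ws : Functional n) → (∀ μ → 0ℚ ℚ.≤ ⟦ ws ⟧ (toℚ ∘ eCoeff n μ)) →
  ∀ L → All (λ p → 0ℚ ℚ.≤ proj₁ p) L → 0ℚ ℚ.≤ ⟦ ws ⟧ (eExpansion n L)
⟦⟧-expansion-nonneg ws e-nonneg []            []         =
  ℚP.≤-reflexive (sym (⟦⟧-vanishing ws {λ _ → 0} (All.tabulate (λ _ → refl))))
⟦⟧-expansion-nonneg {n} ws e-nonneg ((q , μ) ∷ L) (0≤q ∷ 0≤L) =
  subst (0ℚ ℚ.≤_) (sym (⟦⟧-linear ws q (toℚ ∘ eCoeff n μ) (eExpansion n L)))
    (ℚP.+-mono-≤ {0ℚ} {_} {0ℚ} head (⟦⟧-expansion-nonneg ws e-nonneg L 0≤L))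
  where
  head : 0ℚ ℚ.≤ q ℚ.* ⟦ ws ⟧ (toℚ ∘ eCoeff n μ)
  head = ℚP.nonNegative⁻¹ _ {{ℚP.nonNeg*nonNeg⇒nonNeg q {{ℚ.nonNegative 0≤q}}
                                  _ {{ℚ.nonNegative (e-nonneg μ)}}}}

separating-functional : ∀ {N} (G : Graph N) n (ws : Functional n) →
  (∀ μ → 0ℚ ℚ.≤ ⟦ ws ⟧ (toℚ ∘ eCoeff n μ)) → ⟦ ws ⟧ (toℚ ∘ chromCoeff G n) ℚ.< 0ℚ →
  ¬ IsEPositive G
separating-functional G n ws e-nonneg X-negative (L , 0≤L , X≡L) =
  ℚP.<-irrefl refl (ℚP.≤-<-trans 0≤X X-negative)
  where
  0≤X : 0ℚ ℚ.≤ ⟦ ws ⟧ (toℚ ∘ chromCoeff G n)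
  0≤X = subst (0ℚ ℚ.≤_) (⟦⟧-cong ws (All.tabulate (λ _ → sym (X≡L n _))))
              (⟦⟧-expansion-nonneg ws e-nonneg L 0≤L)

allFuns-complete : ∀ N n (f : Fin N → Fin n) → Any (λ g → ∀ i → g i ≡ f i) (allFuns N n)
allFuns-complete zero    n f = here (λ ())
allFuns-complete (suc N) n f =
  concatMap⁺ (λ g → map (λ c → extend c g) (allFin n)) (Any.map extendsTail (allFuns-complete N n (f ∘ suc)))
  where
  extendsTail : ∀ {g} → (∀ i → g i ≡ f (suc i)) →
    Any (λ h → ∀ i → h i ≡ f i) (map (λ c → extend c g) (allFin n))
  extendsTail g≗ = map⁺ (tabulate⁺ (f zero) λ { zero → refl ; (suc i) → g≗ i })

isInducedEmbedding : ∀ {M N} → Graph M → Graph N → (Fin M → Fin N) → Bool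
isInducedEmbedding {M} H G f = all (λ i → all (λ j →
  ⌊ i Fin.≟ j ⌋ ∨ (not ⌊ f i Fin.≟ f j ⌋ ∧ ⌊ adj G (f i) (f j) Bool.≟ adj H i j ⌋))
  (allFin M)) (allFin M)

embedding-accepted : ∀ {M N} (H : Graph M) (G : Graph N) (f : Fin M → Fin N) →
  Injective _≡_ _≡_ f → (∀ i j → adj G (f i) (f j) ≡ adj H i j) →
  ∀ {g} → (∀ i → g i ≡ f i) → isInducedEmbedding H G g ≡ true
embedding-accepted {M} H G f inj adj≡ {g} g≗f =
  all-intro (allFin M) (λ i → all-intro (allFin M) (pairAccepted i))
  where
  pairAccepted : ∀ i j →
    (⌊ i Fin.≟ j ⌋ ∨ (not ⌊ g i Fin.≟ g j ⌋ ∧ ⌊ adj G (g i) (g j) Bool.≟ adj H i j ⌋)) ≡ true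
  pairAccepted i j with i Fin.≟ j
  ... | yes _   = refl
  ... | no i≢j rewrite g≗f i | g≗f j with f i Fin.≟ f j | adj G (f i) (f j) Bool.≟ adj H i j
  ...   | yes fi≡fj | _        = ⊥-elim (i≢j (inj fi≡fj))
  ...   | no _      | yes _    = refl
  ...   | no _      | no adj≢  = ⊥-elim (adj≢ (adj≡ i j))

induced-free : ∀ {M N} (H : Graph M) (G : Graph N) →
  all (λ g → not (isInducedEmbedding H G g)) (allFuns M N) ≡ true → ¬ Induced H G
induced-free {M} {N} H G noEmbedding (f , inj , adj≡) =
  all-Any-false noEmbedding
    (Any.map (λ g≗f → cong not (embedding-accepted H G f inj adj≡ g≗f)) (allFuns-complete M N f))

-- compositions m lists every sequence of parts in {1, 2, 3} (the e_k that
-- survive in three variables) summing to m.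
compositions : ℕ → List (List ℕ)
startingWith2 : ℕ → List (List ℕ)
startingWith3 : ℕ → List (List ℕ)

compositions zero    = [] ∷ []
compositions (suc m) = map (1 ∷_) (compositions m) ++ startingWith2 m ++ startingWith3 m

startingWith2 zero    = []
startingWith2 (suc m) = map (2 ∷_) (compositions m)

startingWith3 zero          = []
startingWith3 (suc zero)    = []
startingWith3 (suc (suc m)) = map (3 ∷_) (compositions m)

∈-compositions : ∀ {ν} → All (0 <_) ν → All (_≤ 3) ν → ν ∈ compositions (sum ν)
∈-compositions [] [] = here refl
∈-compositions {1 ∷ ν} (_ ∷ pos) (_ ∷ small) =
  ∈-++⁺ˡ (∈-map⁺ (1 ∷_) (∈-compositions pos small))
∈-compositions {2 ∷ ν} (_ ∷ pos) (_ ∷ small) =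
  ∈-++⁺ʳ (map (1 ∷_) (compositions (suc (sum ν))))
    (∈-++⁺ˡ (∈-map⁺ (2 ∷_) (∈-compositions pos small)))
∈-compositions {3 ∷ ν} (_ ∷ pos) (_ ∷ small) =
  ∈-++⁺ʳ (map (1 ∷_) (compositions (suc (suc (sum ν)))))
    (∈-++⁺ʳ (startingWith2 (suc (suc (sum ν)))) (∈-map⁺ (3 ∷_) (∈-compositions pos small)))
∈-compositions {suc (suc (suc (suc _))) ∷ _} _ (s≤s (s≤s (s≤s ())) ∷ _)

mono : ℕ → ℕ → ℕ → Fin 3 → ℕ
mono a b c zero             = a
mono a b c (suc zero)       = b
mono a b c (suc (suc zero)) = c

-- The degree-6 symmetric polynomials in x₀, x₁, x₂ have the bases
-- {m_λ} and {e_λ}, λ ⊢ 6 with parts ≤ 3; this functional is the e₍₃,₃₎ entry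
-- of the inverse transition matrix, read off from one monomial per m_λ.
e₃₃-coefficient : Functional 3
e₃₃-coefficient =
  (toℚ 3 , mono 6 0 0) ∷ (ℚ.- toℚ 3 , mono 5 1 0) ∷ (ℚ.- toℚ 3 , mono 4 2 0) ∷
  (toℚ 3 , mono 4 1 1) ∷ (toℚ 3 , mono 3 3 0) ∷ (ℚ.- toℚ 3 , mono 3 2 1) ∷ (toℚ 1 , mono 2 2 2) ∷ []

e₃₃-support : All (λ p → deg (proj₂ p) ≡ 6) e₃₃-coefficient
e₃₃-support = refl ∷ refl ∷ refl ∷ refl ∷ refl ∷ refl ∷ refl ∷ []

e₃₃-vanishing : ∀ {h : (Fin 3 → ℕ) → ℕ} → (∀ α → deg α ≡ 6 → h α ≡ 0) →
  ⟦ e₃₃-coefficient ⟧ (toℚ ∘ h) ≡ 0ℚ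
e₃₃-vanishing h≡0 = ⟦⟧-vanishing e₃₃-coefficient (All.map (λ {p} → h≡0 (proj₂ p)) e₃₃-support)

-- By evaluation: the value is 1 on (3,3) and 0 on the other 23 compositions of 6.
e₃₃-on-compositions : All (λ ν → 0ℚ ℚ.≤ ⟦ e₃₃-coefficient ⟧ (toℚ ∘ eCoeff 3 ν)) (compositions 6)
e₃₃-on-compositions = from-yes (all? (λ ν → 0ℚ ℚP.≤? ⟦ e₃₃-coefficient ⟧ (toℚ ∘ eCoeff 3 ν)) (compositions 6))

-- Nonnegativity on every e_μ: drop the factors e₀; then either some part
-- exceeds 3 (e_μ = 0), or the parts do not sum to 6 (no degree-6 monomials),
-- or μ is one of the enumerated compositions of 6.
e₃₃-nonneg : ∀ μ → 0ℚ ℚ.≤ ⟦ e₃₃-coefficient ⟧ (toℚ ∘ eCoeff 3 μ)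
e₃₃-nonneg μ =
  subst (0ℚ ℚ.≤_) (⟦⟧-cong e₃₃-coefficient {toℚ ∘ eCoeff 3 (dropZeros μ)}
                     (All.tabulate (λ _ → cong toℚ (sym (eCoeff-dropZeros μ _)))))
        (reduced (dropZeros μ) (dropZeros-positive μ))
  where
  reduced : ∀ ν → All (0 <_) ν → 0ℚ ℚ.≤ ⟦ e₃₃-coefficient ⟧ (toℚ ∘ eCoeff 3 ν)
  reduced ν pos with all? (ℕ._≤? 3) ν | sum ν ℕ.≟ 6
  ... | yes small | yes sum≡6 =
    All.lookup e₃₃-on-compositions (subst (λ m → ν ∈ compositions m) sum≡6 (∈-compositions pos small))
  ... | yes _ | no sum≢6 = ℚP.≤-reflexive (sym (e₃₃-vanishing (λ α deg≡6 →
    eCoeff-homogeneous ν α (λ deg≡sum → sum≢6 (trans (sym deg≡sum) deg≡6)))))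
  ... | no large | _ = ℚP.≤-reflexive (sym (e₃₃-vanishing (λ α _ →
    eCoeff-large-part ν (Any.map ≰⇒> (¬All⇒Any¬ (ℕ._≤? 3) ν large)) α)))

netEdge : ℕ → ℕ → Bool
netEdge 0 1 = true
netEdge 0 2 = true
netEdge 1 2 = true
netEdge 0 3 = true
netEdge 1 4 = true
netEdge 2 5 = true
netEdge _ _ = false

netAdj : Fin 6 → Fin 6 → Bool
netAdj i j = netEdge (Fin.toℕ i) (Fin.toℕ j) ∨ netEdge (Fin.toℕ j) (Fin.toℕ i)

net : Graph 6
net = record
  { adj    = netAdj
  ; sym    = λ i j → ∨-comm (netEdge (Fin.toℕ i) (Fin.toℕ j)) _
  ; irrefl = irrefl′ }
  where
  irrefl′ : ∀ i → netAdj i i ≡ false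
  irrefl′ zero                                = refl
  irrefl′ (suc zero)                          = refl
  irrefl′ (suc (suc zero))                    = refl
  irrefl′ (suc (suc (suc zero)))              = refl
  irrefl′ (suc (suc (suc (suc zero))))        = refl
  irrefl′ (suc (suc (suc (suc (suc zero)))))  = refl

net-e₃₃ : ⟦ e₃₃-coefficient ⟧ (toℚ ∘ chromCoeff net 3) ≡ ℚ.- toℚ 6
net-e₃₃ = refl

net-not-e-positive : ¬ IsEPositive net
net-not-e-positive = separating-functional net 3 e₃₃-coefficient e₃₃-nonneg
  (subst (ℚ._< 0ℚ) (sym net-e₃₃) (from-yes (ℚ.- toℚ 6 ℚP.<? 0ℚ)))

net-witness : ∀ H → all (λ g → not (isInducedEmbedding H net g)) (allFuns 4 6) ≡ true →
  NonEPositiveFree claw H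
net-witness H H-free =
  6 , net , induced-free claw net refl , induced-free H net H-free , net-not-e-positive

lemma7 : NonEPositiveFree claw diamond
       × NonEPositiveFree claw K4
       × NonEPositiveFree claw 4K1
       × NonEPositiveFree claw C4
       × NonEPositiveFree claw 2K2
       × NonEPositiveFree claw co-claw
lemma7 = net-witness diamond refl , net-witness K4 refl , net-witness 4K1 refl
       , net-witness C4 refl , net-witness 2K2 refl , net-witness co-claw refl
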